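{- For every command $C$ and every deterministic assertion $\phi$, the triple $\vdash\{wp(C,\phi)\}C\{\phi\}$ is derivable in the proof system $\mathrm{QHL}_d$.
   Context: Setting. Program variables $\mathbb{PV}$, logical variables $\mathbb{LV}$, quantum variables $q_1,\dots,q_m$ (qubits), $\mathcal H$ their joint Hilbert space. Arithmetic expressions $E::=n\mid X\mid(E\ aop\ E)$; Boolean expressions $B::=\top\mid\bot\mid(E\ rop\ E)\mid\neg B\mid(B\wedge B)$. Pure cq-states $\theta=(\theta_c,\theta_q)$ with $\theta_c:\mathbb{PV}\to\mathbb Z$ and $\theta_q$ a unit vector of $\mathcal H$ (up to global phase); probabilistic cq-states are subdistributions $\Theta$ on pure cq-states, with support $sp(\Theta)$, point distribution $\widehat\theta$, and $\downarrow_B(\Theta)(\theta)=\Theta(\theta)$ if $[\![B]\!]\theta_c=\top$, else $0$. Commands $C::=skip\mid X\leftarrow E\mid X\xleftarrow{\$}\{a_1:k_1,\dots,a_n:k_n\}\mid C_1;C_2\mid if\ B\ then\ C_1\ else\ C_2\mid while\ B\ do\ C\mid U[\overline q]\mid X\leftleftarrows q_i$ with semantics: $[\![skip]\!]\Theta=\Theta$; $[\![X\leftarrow E]\!]\widehat\theta=\widehat{(\theta_c[X\mapsto[\![E]\!]\theta_c],\theta_q)}$; $[\![X\xleftarrow{\$}\{a_i:k_i\}]\!]\Theta=\sum_ia_i[\![X\leftarrow k_i]\!]\Theta$; $[\![C_1;C_2]\!]=[\![C_2]\!]\circ[\![C_1]\!]$; $[\![if\ B\ then\ C_1\ else\ C_2]\!]\Theta=[\![C_1]\!](\downarrow_B\Theta)+[\![C_2]\!](\downarrow_{\neg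 B}\Theta)$; $[\![while\ B\ do\ C]\!]\Theta=\sum_{i\ge0}\downarrow_{\neg B}(([\![C]\!]\circ\downarrow_B)^i\Theta)$; $[\![U[\overline q]]\!]\widehat\theta=\widehat{(\theta_c,U_{\overline q}\theta_q)}$; $[\![X\leftleftarrows q_i]\!]\widehat\theta=\sum_{j=0}^1p_j\widehat{\theta_j}$, $p_j=\mathrm{Tr}((|j\rangle\langle j|\otimes I_{ -i})\theta_q\theta_q^\dagger)$, $\theta_{j}=(\theta_c[X\mapsto j],(|j\rangle\langle j|\otimes I_{ -i})\theta_q/\sqrt{p_j})$; linear extension to arbitrary $\Theta$. Deterministic assertions $\phi::=\top\mid\bot\mid P^0_j\mid P^1_j\mid(e\ rop\ e)\mid\neg\phi\mid(\phi\wedge\phi)\mid\forall x\phi\mid[U_{\overline q}]\phi\mid[\mathfrak P^0_j]\phi\mid[\mathfrak P^1_j]\phi\mid\bigwedge_{i=0}^\infty\phi_i$ with $e::=n\mid X\mid x\mid(e\ aop\ e)$, interpreted over pure cq-states with an interpretation $I:\mathbb{LV}\to\mathbb Z$: $P^i_j$ iff $\mathrm{Tr}(|i\rangle\langle i|\mathrm{Tr}_{ -j}(\theta_q\theta_q^\dagger))=1$; $e_1\ rop\ e_2$ evaluated with $\theta_c$ and $I$; classical connectives; $\forall x$ over integers; $[U_{\overline q}]\phi$ iff $(\theta_c,U_{\overline q}\theta_q)\models^I\phi$; $[\mathfrak P^i_j]\phi$ iff $p_i=\mathrm{Tr}((|i\rangle\langle i|_j\otimes I_{ -j})\theta_q\theta_q^\dagger)>0$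 and $(\theta_c,(|i\rangle\langle i|_j\otimes I_{ -j})\theta_q/\sqrt{p_i})\models^I\phi$. $\Theta\models^I\phi$ iff all $\theta\in sp(\Theta)$ satisfy $\phi$. $\models\phi\to\psi$ means implication holds at all $I,\theta$. $\phi[X/E]$ is substitution. Proof system $\mathrm{QHL}_d$: SKIP $\vdash\{\phi\}skip\{\phi\}$; AS $\vdash\{\phi[X/E]\}X\leftarrow E\{\phi\}$; PAS $\vdash\{\phi[X/k_1]\wedge\cdots\wedge\phi[X/k_n]\}X\xleftarrow{\$}\{a_1:k_1,\dots,a_n:k_n\}\{\phi\}$; SEQ from $\vdash\{\phi\}C_1\{\phi_1\}$, $\vdash\{\phi_1\}C_2\{\phi_2\}$ infer $\vdash\{\phi\}C_1;C_2\{\phi_2\}$; IF from $\vdash\{\phi\wedge B\}C_1\{\psi\}$, $\vdash\{\phi\wedge\neg B\}C_2\{\psi\}$ infer $\vdash\{\phi\}if\ B\ then\ C_1\ else\ C_2\{\psi\}$; WHILE from $\vdash\{\phi\wedge B\}C\{\phi\}$ infer $\vdash\{\phi\}while\ B\ do\ C\{\phi\wedge\neg B\}$; UNITARY $\vdash\{[U_{\overline q}]\phi\}U[\overline q]\{\phi\}$; MEASURE $\vdash\{([\mathfrak P^0_j]\phi[X/0]\vee P^1_j)\wedge([\mathfrak P^1_j]\phi[X/1]\vee P^0_j)\}X\leftleftarrows q_j\{\phi\}$; CONS from $\models\phi'\to\phi$, $\vdash\{\phi\}C\{\psi\}$, $\models\psi\to\psi'$ infer $\vdash\{\phi'\}C\{\psi'\}$.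 Weakest precondition: $wp(skip,\phi)=\phi$; $wp(X\leftarrow E,\phi)=\phi[X/E]$; $wp(X\xleftarrow{\$}\{a_i:k_i\},\phi)=\bigwedge_{i=1}^n\phi[X/k_i]$; $wp(C_1;C_2,\phi)=wp(C_1,wp(C_2,\phi))$; $wp(if\ B\ then\ C_1\ else\ C_2,\phi)=(B\wedge wp(C_1,\phi))\vee(\neg B\wedge wp(C_2,\phi))$; $wp(while\ B\ do\ C,\phi)=\bigwedge_{k\ge0}\psi_k$, $\psi_0=\top$, $\psi_{i+1}=(B\wedge wp(C,\psi_i))\vee(\neg B\wedge\phi)$; $wp(U[\overline q],\phi)=[U_{\overline q}]\phi$; $wp(X\leftleftarrows q_j,\phi)=([\mathfrak P^0_j]\phi[X/0]\vee P^1_j)\wedge([\mathfrak P^1_j]\phi[X/1]\vee P^0_j)$. -}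

module Defs where

open import Data.Nat using (ℕ; zero; suc; _≡ᵇ_)
open import Data.Integer using (ℤ; _+_; _-_; _*_; _<_; _≤_; 0ℤ; 1ℤ)
open import Data.Fin using (Fin)
import Data.Fin as Fin
open import Data.Bool using (if_then_else_)
open import Data.Product using (Σ; _×_; _,_)
open import Data.List using (List; []; _∷_)
open import Data.Unit using (⊤)
open import Data.Empty using (⊥)
open import Relation.Nullary using (¬_)
open import Relation.Binary.PropositionalEquality using (_≡_)

-- QState : pure quantum states (unit vectors of H up to global phase)
-- Unitary : the operators U_q̄ (a unitary U applied to qubits q̄)
-- P i j s : the atomic assertion P^i_j, Tr(|i⟩⟨i| Tr_{-j}(θθ†)) = 1
-- Pos i j s : p_i = Tr((|i⟩⟨i|_j ⊗ I) θθ†) > 0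
-- post i j s : the normalised post-measurement state
-- Weight : the probabilities a_i in probabilistic assignments

record Model : Set₁ where
  field
    nq      : ℕ
    QState  : Set
    Unitary : Set
    apply   : Unitary → QState → QState
    P       : Fin 2 → Fin nq → QState → Set
    Pos     : Fin 2 → Fin nq → QState → Set
    post    : Fin 2 → Fin nq → QState → QState
    Weight  : Set

PVar : Set
PVar = ℕ

LVar : Set
LVar = ℕ

data AOp : Set where
  plus minus times : AOp

data ROp : Set where
  eq lt le : ROp

data AExp : Set where
  num : ℤ → AExp
  pv  : PVar → AExp
  op  : AOp → AExp → AExp → AExp

data BExp : Set where
  btrue bfalse : BExp
  bcmp : ROp → AExp → AExp → BExp
  bneg : BExp → BExp
  band : BExp → BExp → BExp

data Term : Set where
  num : ℤ → Term
  pv  : PVar → Term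
  lv  : LVar → Term
  op  : AOp → Term → Term → Term

module _ (M : Model) where
  open Model M

  data Cmd : Set where
    skip    : Cmd
    assign  : PVar → AExp → Cmd
    -- X ←$ {a_1:k_1, …, a_n:k_n}, n ≥ 1 (head pair, then the rest)
    passign : PVar → (Weight × ℤ) → List (Weight × ℤ) → Cmd
    seq     : Cmd → Cmd → Cmd
    ite     : BExp → Cmd → Cmd → Cmd
    while   : BExp → Cmd → Cmd
    unitary : Unitary → Cmd
    measure : PVar → Fin nq → Cmd

  data Assn : Set where
    tt ff  : Assn
    proj   : Fin 2 → Fin nq → Assn
    cmp    : ROp → Term → Term → Assn
    neg    : Assn → Assn
    and    : Assn → Assn → Assn
    all    : LVar → Assn → Assn
    box    : Unitary → Assn → Assn
    mbox   : Fin 2 → Fin nq → Assn → Assn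
    bigand : (ℕ → Assn) → Assn

  or : Assn → Assn → Assn
  or φ ψ = neg (and (neg φ) (neg ψ))

  ⌜_⌝ₐ : AExp → Term
  ⌜ num n ⌝ₐ = num n
  ⌜ pv X ⌝ₐ = pv X
  ⌜ op o a b ⌝ₐ = op o ⌜ a ⌝ₐ ⌜ b ⌝ₐ

  ⌜_⌝ᵦ : BExp → Assn
  ⌜ btrue ⌝ᵦ = tt
  ⌜ bfalse ⌝ᵦ = ff
  ⌜ bcmp r a b ⌝ᵦ = cmp r ⌜ a ⌝ₐ ⌜ b ⌝ₐ
  ⌜ bneg b ⌝ᵦ = neg ⌜ b ⌝ᵦ
  ⌜ band b c ⌝ᵦ = and ⌜ b ⌝ᵦ ⌜ c ⌝ᵦ

  -- substitution [X/E] (E contains no logical variables, so no capture)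
  substT : PVar → AExp → Term → Term
  substT X E (num n) = num n
  substT X E (pv Y) = if Y ≡ᵇ X then ⌜ E ⌝ₐ else pv Y
  substT X E (lv x) = lv x
  substT X E (op o a b) = op o (substT X E a) (substT X E b)

  _[_/_] : Assn → PVar → AExp → Assn
  tt [ X / E ] = tt
  ff [ X / E ] = ff
  proj i j [ X / E ] = proj i j
  cmp r a b [ X / E ] = cmp r (substT X E a) (substT X E b)
  neg φ [ X / E ] = neg (φ [ X / E ])
  and φ ψ [ X / E ] = and (φ [ X / E ]) (ψ [ X / E ])
  all x φ [ X / E ] = all x (φ [ X / E ])
  box U φ [ X / E ] = box U (φ [ X / E ])
  mbox i j φ [ X / E ] = mbox i j (φ [ X / E ])
  bigand f [ X / E ] = bigand (λ n → f n [ X / E ])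

  evalOp : AOp → ℤ → ℤ → ℤ
  evalOp plus a b = a + b
  evalOp minus a b = a - b
  evalOp times a b = a * b

  evalR : ROp → ℤ → ℤ → Set
  evalR eq a b = a ≡ b
  evalR lt a b = a < b
  evalR le a b = a ≤ b

  evalT : (LVar → ℤ) → (PVar → ℤ) → Term → ℤ
  evalT I c (num n) = n
  evalT I c (pv X) = c X
  evalT I c (lv x) = I x
  evalT I c (op o a b) = evalOp o (evalT I c a) (evalT I c b)

  updI : (LVar → ℤ) → LVar → ℤ → (LVar → ℤ)
  updI I x z y = if y ≡ᵇ x then z else I y

  Sat : (LVar → ℤ) → (PVar → ℤ) → QState → Assn → Set
  Sat I c q tt = ⊤
  Sat I c q ff = ⊥
  Sat I c q (proj i j) = P i j q
  Sat I c q (cmp r a b) = evalR r (evalT I c a) (evalT I c b)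
  Sat I c q (neg φ) = ¬ Sat I c q φ
  Sat I c q (and φ ψ) = Sat I c q φ × Sat I c q ψ
  Sat I c q (all x φ) = (z : ℤ) → Sat (updI I x z) c q φ
  Sat I c q (box U φ) = Sat I c (apply U q) φ
  Sat I c q (mbox i j φ) = Pos i j q × Sat I c (post i j q) φ
  Sat I c q (bigand f) = (n : ℕ) → Sat I c q (f n)

  Valid→ : Assn → Assn → Set
  Valid→ φ ψ = (I : LVar → ℤ) (c : PVar → ℤ) (q : QState) → Sat I c q φ → Sat I c q ψ

  conjSubst : Assn → PVar → (Weight × ℤ) → List (Weight × ℤ) → Assn
  conjSubst φ X (a , k) [] = φ [ X / num k ]
  conjSubst φ X (a , k) (p ∷ ps) = and (φ [ X / num k ]) (conjSubst φ X p ps)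

  measPre : Assn → PVar → Fin nq → Assn
  measPre φ X j =
    and (or (mbox Fin.zero j (φ [ X / num 0ℤ ])) (proj (Fin.suc Fin.zero) j))
        (or (mbox (Fin.suc Fin.zero) j (φ [ X / num 1ℤ ])) (proj Fin.zero j))

  data ⊢ : Assn → Cmd → Assn → Set where
    SKIP    : ∀ {φ} → ⊢ φ skip φ
    AS      : ∀ {φ X E} → ⊢ (φ [ X / E ]) (assign X E) φ
    PAS     : ∀ {φ X p ps} → ⊢ (conjSubst φ X p ps) (passign X p ps) φ
    SEQ     : ∀ {φ φ₁ φ₂ C₁ C₂} → ⊢ φ C₁ φ₁ → ⊢ φ₁ C₂ φ₂ → ⊢ φ (seq C₁ C₂) φ₂
    IF      : ∀ {φ ψ B C₁ C₂} → ⊢ (and φ ⌜ B ⌝ᵦ) C₁ ψ → ⊢ (and φ (neg ⌜ B ⌝ᵦ)) C₂ ψ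
              → ⊢ φ (ite B C₁ C₂) ψ
    WHILE   : ∀ {φ B C} → ⊢ (and φ ⌜ B ⌝ᵦ) C φ → ⊢ φ (while B C) (and φ (neg ⌜ B ⌝ᵦ))
    UNITARY : ∀ {φ U} → ⊢ (box U φ) (unitary U) φ
    MEASURE : ∀ {φ X j} → ⊢ (measPre φ X j) (measure X j) φ
    CONS    : ∀ {φ φ' ψ ψ' C} → Valid→ φ' φ → ⊢ φ C ψ → Valid→ ψ ψ' → ⊢ φ' C ψ'

  wp : Cmd → Assn → Assn
  wpW : BExp → Cmd → Assn → ℕ → Assn
  wp skip φ = φ
  wp (assign X E) φ = φ [ X / E ]
  wp (passign X p ps) φ = conjSubst φ X p ps
  wp (seq C₁ C₂) φ = wp C₁ (wp C₂ φ)
  wp (ite B C₁ C₂) φ = or (and ⌜ B ⌝ᵦ (wp C₁ φ)) (and (neg ⌜ B ⌝ᵦ) (wp C₂ φ))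
  wp (while B C) φ = bigand (wpW B C φ)
  wp (unitary U) φ = box U φ
  wp (measure X j) φ = measPre φ X j
  wpW B C φ zero = tt
  wpW B C φ (suc i) = or (and ⌜ B ⌝ᵦ (wp C (wpW B C φ i))) (and (neg ⌜ B ⌝ᵦ) φ)

{-# OPTIONS --safe #-}
module Submission where

-- Every rule of QHL_d except WHILE has exactly the corresponding wp clause as its
-- precondition; for IF one only strengthens by a case split on B. For a loop the
-- precondition W = ⋀ₖ ψₖ is itself an invariant: W ∧ B entails wp(C, ψₖ) for every k,
-- and these together entail wp(C, W) because wp(C, –) is monotone and preserves
-- countable conjunctions up to entailment (induction on C, with an inner induction on k
-- for loops). Excluded middle is needed because ∨ is encoded as ¬(¬_ ∧ ¬_).

open import Defs
open import Level using (0ℓ)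
open import Axiom.ExcludedMiddle using (ExcludedMiddle)
open import Axiom.DoubleNegationElimination using (em⇒dne)
open import Data.Nat using (ℕ; zero; suc; _≡ᵇ_)
open import Data.Integer using (ℤ; 0ℤ; 1ℤ)
open import Data.Bool using (true; false; if_then_else_)
open import Data.Product using (_,_; proj₁; proj₂)
open import Data.Product.Function.NonDependent.Propositional using (_×-⇔_)
open import Data.List using ([]; _∷_)
open import Data.Unit using (tt)
open import Function using (_∘_)
open import Function.Bundles using (_⇔_; mk⇔; module Equivalence)
open import Function.Construct.Identity using (⇔-id)
open import Function.Related.TypeIsomorphisms using (¬-cong-⇔)
open import Relation.Nullary using (¬_)
open import Relation.Binary.PropositionalEquality using (_≡_; refl; cong₂)

open Equivalence using (to; from)

Π-cong-⇔ : {A : Set} {P Q : A → Set} → (∀ x → P x ⇔ Q x) → (∀ x → P x) ⇔ (∀ x → Q x)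
Π-cong-⇔ P⇔Q = mk⇔ (λ p x → to (P⇔Q x) (p x)) (λ q x → from (P⇔Q x) (q x))

module _ (M : Model) where
  open Model M

  ⟦_⟧ₐ : AExp → (PVar → ℤ) → ℤ
  ⟦ num n ⟧ₐ c = n
  ⟦ pv X ⟧ₐ c = c X
  ⟦ op o a b ⟧ₐ c = evalOp M o (⟦ a ⟧ₐ c) (⟦ b ⟧ₐ c)

  update : (PVar → ℤ) → PVar → ℤ → (PVar → ℤ)
  update c X v Y = if Y ≡ᵇ X then v else c Y

  evalT-⌜⌝ₐ : ∀ I c E → evalT M I c (⌜_⌝ₐ M E) ≡ ⟦ E ⟧ₐ c
  evalT-⌜⌝ₐ I c (num n) = refl
  evalT-⌜⌝ₐ I c (pv X) = refl
  evalT-⌜⌝ₐ I c (op o a b) = cong₂ (evalOp M o) (evalT-⌜⌝ₐ I c a) (evalT-⌜⌝ₐ I c b)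

  evalT-substT : ∀ I c X E t →
    evalT M I c (substT M X E t) ≡ evalT M I (update c X (⟦ E ⟧ₐ c)) t
  evalT-substT I c X E (num n) = refl
  evalT-substT I c X E (pv Y) with Y ≡ᵇ X
  ... | true = evalT-⌜⌝ₐ I c E
  ... | false = refl
  evalT-substT I c X E (lv x) = refl
  evalT-substT I c X E (op o a b) =
    cong₂ (evalOp M o) (evalT-substT I c X E a) (evalT-substT I c X E b)

  Sat-subst : ∀ I c q X E φ →
    Sat M I c q (_[_/_] M φ X E) ⇔ Sat M I (update c X (⟦ E ⟧ₐ c)) q φ
  Sat-subst I c q X E tt = ⇔-id _
  Sat-subst I c q X E ff = ⇔-id _
  Sat-subst I c q X E (proj i j) = ⇔-id _
  Sat-subst I c q X E (cmp r a b)
    rewrite evalT-substT I c X E a | evalT-substT I c X E b = ⇔-id _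
  Sat-subst I c q X E (neg φ) = ¬-cong-⇔ (Sat-subst I c q X E φ)
  Sat-subst I c q X E (and φ ψ) = Sat-subst I c q X E φ ×-⇔ Sat-subst I c q X E ψ
  Sat-subst I c q X E (all x φ) = Π-cong-⇔ λ z → Sat-subst (updI M I x z) c q X E φ
  Sat-subst I c q X E (box U φ) = Sat-subst I c (apply U q) X E φ
  Sat-subst I c q X E (mbox i j φ) = ⇔-id _ ×-⇔ Sat-subst I c (post i j q) X E φ
  Sat-subst I c q X E (bigand f) = Π-cong-⇔ λ n → Sat-subst I c q X E (f n)

  -- A record rather than a synonym for Valid→, so that f and ψ are inferable.
  record _⋀⊨_ (f : ℕ → Assn M) (ψ : Assn M) : Set where
    constructor ⋀-entails
    field entails : Valid→ M (bigand f) ψ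
  open _⋀⊨_

  ⋀-Continuous : (Assn M → Assn M) → Set
  ⋀-Continuous T = ∀ {f ψ} → f ⋀⊨ ψ → (T ∘ f) ⋀⊨ T ψ

  ⋀-Continuous₂ : (Assn M → Assn M → Assn M) → Set
  ⋀-Continuous₂ T = ∀ {f g φ ψ} → f ⋀⊨ φ → g ⋀⊨ ψ → (λ n → T (f n) (g n)) ⋀⊨ T φ ψ

  subst-continuous : ∀ X E → ⋀-Continuous (λ φ → _[_/_] M φ X E)
  subst-continuous X E {f} {ψ} (⋀-entails f⊨ψ) = ⋀-entails λ I c q fs →
    from (Sat-subst I c q X E ψ)
      (f⊨ψ I _ q λ n → to (Sat-subst I c q X E (f n)) (fs n))

  box-continuous : ∀ U → ⋀-Continuous (box U)
  box-continuous U (⋀-entails f⊨ψ) = ⋀-entails λ I c q → f⊨ψ I c (apply U q)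

  mbox-continuous : ∀ i j → ⋀-Continuous (mbox i j)
  mbox-continuous i j (⋀-entails f⊨ψ) = ⋀-entails λ I c q fs →
    proj₁ (fs 0) , f⊨ψ I c (post i j q) (proj₂ ∘ fs)

  and-continuous : ⋀-Continuous₂ and
  and-continuous (⋀-entails f⊨φ) (⋀-entails g⊨ψ) = ⋀-entails λ I c q fgs →
    f⊨φ I c q (proj₁ ∘ fgs) , g⊨ψ I c q (proj₂ ∘ fgs)

  conjSubst-continuous : ∀ X p ps → ⋀-Continuous (λ φ → conjSubst M φ X p ps)
  conjSubst-continuous X (a , k) [] = subst-continuous X (num k)
  conjSubst-continuous X (a , k) (p ∷ ps) f⊨ψ =
    and-continuous (subst-continuous X (num k) f⊨ψ) (conjSubst-continuous X p ps f⊨ψ)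

  cond : Assn M → Assn M → Assn M → Assn M
  cond β φ ψ = or M (and β φ) (and (neg β) ψ)

  cond-intro : ∀ {I c q} β φ ψ →
    (Sat M I c q β → Sat M I c q φ) → (¬ Sat M I c q β → Sat M I c q ψ) →
    Sat M I c q (cond β φ ψ)
  cond-intro β φ ψ β→φ ¬β→ψ (¬[β∧φ] , ¬[¬β∧ψ]) = ¬[¬β∧ψ] (¬β , ¬β→ψ ¬β)
    where ¬β = λ b → ¬[β∧φ] (b , β→φ b)

  module _ (em : ExcludedMiddle 0ℓ) where

    cond-true : ∀ β φ ψ → Valid→ M (and (cond β φ ψ) β) φ
    cond-true β φ ψ I c q (β?φ:ψ , b) =
      em⇒dne em λ ¬φ → β?φ:ψ ((λ (_ , x) → ¬φ x) , (λ (¬b , _) → ¬b b))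

    cond-false : ∀ β φ ψ → Valid→ M (and (cond β φ ψ) (neg β)) ψ
    cond-false β φ ψ I c q (β?φ:ψ , ¬b) =
      em⇒dne em λ ¬ψ → β?φ:ψ ((λ (b , _) → ¬b b) , (λ (_ , y) → ¬ψ y))

    cond-continuous : ∀ β → ⋀-Continuous₂ (cond β)
    cond-continuous β {f} {g} {φ} {ψ} (⋀-entails f⊨φ) (⋀-entails g⊨ψ) =
      ⋀-entails λ I c q hs → cond-intro β φ ψ
        (λ b → f⊨φ I c q λ n → cond-true β (f n) (g n) I c q (hs n , b))
        (λ ¬b → g⊨ψ I c q λ n → cond-false β (f n) (g n) I c q (hs n , ¬b))

    or-continuousˡ : ∀ P → ⋀-Continuous (λ φ → or M φ P)
    or-continuousˡ P (⋀-entails f⊨ψ) = ⋀-entails λ I c q hs (¬ψ , ¬P) →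
      ¬ψ (f⊨ψ I c q λ n → em⇒dne em λ ¬fn → hs n (¬fn , ¬P))

    measPre-continuous : ∀ X j → ⋀-Continuous (λ φ → measPre M φ X j)
    measPre-continuous X j f⊨ψ =
      and-continuous
        (or-continuousˡ _ (mbox-continuous _ j (subst-continuous X (num 0ℤ) f⊨ψ)))
        (or-continuousˡ _ (mbox-continuous _ j (subst-continuous X (num 1ℤ) f⊨ψ)))

    wpW-continuous : ∀ B C → ⋀-Continuous (wp M C) →
      ∀ k → ⋀-Continuous (λ φ → wpW M B C φ k)
    wpW-continuous B C wpC-continuous zero f⊨ψ = ⋀-entails λ _ _ _ _ → tt
    wpW-continuous B C wpC-continuous (suc k) f⊨ψ =
      cond-continuous (⌜_⌝ᵦ M B)
        (wpC-continuous (wpW-continuous B C wpC-continuous k f⊨ψ)) f⊨ψ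

    wp-continuous : ∀ C → ⋀-Continuous (wp M C)
    wp-continuous skip f⊨ψ = f⊨ψ
    wp-continuous (assign X E) = subst-continuous X E
    wp-continuous (passign X p ps) = conjSubst-continuous X p ps
    wp-continuous (seq C₁ C₂) f⊨ψ = wp-continuous C₁ (wp-continuous C₂ f⊨ψ)
    wp-continuous (ite B C₁ C₂) f⊨ψ =
      cond-continuous (⌜_⌝ᵦ M B) (wp-continuous C₁ f⊨ψ) (wp-continuous C₂ f⊨ψ)
    wp-continuous (while B C) f⊨ψ = ⋀-entails λ I c q hs k →
      entails (wpW-continuous B C (wp-continuous C) k f⊨ψ) I c q λ n → hs n k
    wp-continuous (unitary U) = box-continuous U
    wp-continuous (measure X j) = measPre-continuous X j

    strengthen : ∀ {φ φ′ C ψ} → Valid→ M φ′ φ → ⊢ M φ C ψ → ⊢ M φ′ C ψ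
    strengthen φ′⊨φ ⊢φCψ = CONS φ′⊨φ ⊢φCψ λ _ _ _ s → s

    wp-derivable : ∀ C φ → ⊢ M (wp M C φ) C φ
    wp-derivable skip φ = SKIP
    wp-derivable (assign X E) φ = AS
    wp-derivable (passign X p ps) φ = PAS
    wp-derivable (seq C₁ C₂) φ = SEQ (wp-derivable C₁ (wp M C₂ φ)) (wp-derivable C₂ φ)
    wp-derivable (ite B C₁ C₂) φ =
      IF (strengthen (cond-true (⌜_⌝ᵦ M B) (wp M C₁ φ) (wp M C₂ φ)) (wp-derivable C₁ φ))
         (strengthen (cond-false (⌜_⌝ᵦ M B) (wp M C₁ φ) (wp M C₂ φ)) (wp-derivable C₂ φ))
    wp-derivable (while B C) φ =
      CONS (λ _ _ _ w → w) (WHILE (strengthen invariant (wp-derivable C W))) exit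
      where
        W = wp M (while B C) φ

        invariant : Valid→ M (and W (⌜_⌝ᵦ M B)) (wp M C W)
        invariant I c q (w , b) =
          entails (wp-continuous C (⋀-entails λ _ _ _ w′ → w′)) I c q
            λ k → cond-true (⌜_⌝ᵦ M B) (wp M C (wpW M B C φ k)) φ I c q (w (suc k) , b)

        exit : Valid→ M (and W (neg (⌜_⌝ᵦ M B))) φ
        exit I c q (w , ¬b) =
          cond-false (⌜_⌝ᵦ M B) (wp M C (wpW M B C φ 0)) φ I c q (w 1 , ¬b)
    wp-derivable (unitary U) φ = UNITARY
    wp-derivable (measure X j) φ = MEASURE

proposition1 : (M : Model) → ExcludedMiddle 0ℓ →
    (C : Cmd M) (φ : Assn M) → ⊢ M (wp M C φ) C φ
proposition1 = wp-derivable
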